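{- Let $X$ be a finite set of alternatives with $|X|=m\geq 3$ and $N=\{1,\dots,n\}$ with $n\geq 3$. If a social choice correspondence $G$ on $L(X)^N$ satisfies tops-only and balancedness, then $G$ is constant on the set of all non-unanimous profiles, i.e. on all profiles $u$ for which it is not the case that all individuals have the same top-ranked alternative.
   Context: An ordering on $X$ is a strict linear order (complete, asymmetric, transitive relation) on $X$; $L(X)$ is the set of all orderings; for an ordering $r$, $r[1]$ is its highest-ranked element. A profile is $u=(u(1),\dots,u(n))\in L(X)^N$. A social choice correspondence is a map $G$ from $L(X)^N$ to non-empty subsets of $X$. $G$ satisfies tops-only if for all profiles $u,v$ with $u(i)[1]=v(i)[1]$ for all $i$, $G(u)=G(v)$. Profile $v$ is constructed from $u$ by transposition pair $(x,y)$ via individuals $i$ and $j$ if at $u$, $x$ is immediately above $y$ in $u(i)$ and $y$ is immediately above $x$ in $u(j)$, and $v$ equals $u$ except that $x$ and $y$ are swapped in the orderings of $i$ and $j$. $G$ satisfies balancedness if $G(v)=G(u)$ whenever $v$ is constructed from $u$ by some transposition pair via some two individuals. -}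

module Defs where

open import Data.Nat using (ℕ)
open import Data.Fin using (Fin)
open import Data.Fin.Subset using (Subset; Nonempty)
open import Data.Product using (Σ; _×_; _,_; ∃)
open import Data.Sum using (_⊎_)
open import Relation.Nullary using (¬_)
open import Relation.Binary.PropositionalEquality using (_≡_; _≢_)
open import Relation.Binary.Structures using (IsStrictTotalOrder)

-- The set of alternatives X is Fin m; individuals N are Fin n.

record Ordering (m : ℕ) : Set₁ where
  field
    _≻_ : Fin m → Fin m → Set
    isSTO : IsStrictTotalOrder _≡_ _≻_
open Ordering public

IsTop : ∀ {m} → Ordering m → Fin m → Set
IsTop r x = ∀ y → y ≢ x → _≻_ r x y

ImmAbove : ∀ {m} → Ordering m → Fin m → Fin m → Set
ImmAbove r x y = _≻_ r x y × (∀ z → ¬ (_≻_ r x z × _≻_ r z y))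

Profile : ℕ → ℕ → Set₁
Profile m n = Fin n → Ordering m

SCC : ℕ → ℕ → Set₁
SCC m n = Profile m n → Subset m

IsSCC : ∀ {m n} → SCC m n → Set₁
IsSCC G = ∀ u → Nonempty (G u)

SameOrder : ∀ {m} → Ordering m → Ordering m → Set
SameOrder r s = ∀ a b → (_≻_ r a b → _≻_ s a b) × (_≻_ s a b → _≻_ r a b)

Swapped : ∀ {m} → Ordering m → Fin m → Fin m → Ordering m → Set
Swapped r x y s =
  (∀ a b → ¬ ((a ≡ x × b ≡ y) ⊎ (a ≡ y × b ≡ x)) →
     (_≻_ r a b → _≻_ s a b) × (_≻_ s a b → _≻_ r a b))
  × _≻_ s y x

TranspositionPair : ∀ {m n} → Profile m n → Profile m n →
                    Fin m → Fin m → Fin n → Fin n → Set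
TranspositionPair u v x y i j =
  ImmAbove (u i) x y × ImmAbove (u j) y x
  × Swapped (u i) x y (v i) × Swapped (u j) y x (v j)
  × (∀ k → k ≢ i → k ≢ j → SameOrder (u k) (v k))

TopsOnly : ∀ {m n} → SCC m n → Set₁
TopsOnly {m} {n} G = ∀ (u v : Profile m n) →
  (∀ i x → (IsTop (u i) x → IsTop (v i) x) × (IsTop (v i) x → IsTop (u i) x)) →
  G u ≡ G v

Balanced : ∀ {m n} → SCC m n → Set₁
Balanced {m} {n} G = ∀ (u v : Profile m n) x y i j →
  TranspositionPair u v x y i j → G v ≡ G u

Unanimous : ∀ {m n} → Profile m n → Set
Unanimous {m} {n} u = ∃ λ (x : Fin m) → ∀ i → IsTop (u i) x

-- By tops-only, G u depends only on the vector of tops of u, so G induces a map g on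
-- top vectors Fin n → Fin m. Balancedness lets voter i move his top from x to y whenever
-- another voter j has a third top z: if i ranks x > y and j ranks z > y > x, transposing
-- (x,y) for i and j changes only i's top. When no such j exists, a third alternative
-- serves as a stepping stone, so g agrees on any two non-constant vectors that differ
-- in one coordinate. To pass from a non-constant a to a non-constant b, overwrite one
-- coordinate k at a time with b k; should that make the vector constant, first overwrite
-- a coordinate j with b j ≠ b k.

module Submission where

open import Defs
open import Data.Fin using (Fin; zero; suc; toℕ)
open import Data.Fin.Properties using (all?; ¬∀⟶∃¬; toℕ-injective) renaming (_≟_ to _≟ᶠ_)
open import Data.Fin.Subset using (Subset)
open import Data.List using (List; []; _∷_; allFin)
import Data.List.Extrema
open import Data.List.Membership.Propositional using (_∉_)
open import Data.List.Membership.Propositional.Properties using (∈-allFin)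
open import Data.List.Relation.Unary.All using (lookup)
open import Data.List.Relation.Unary.Any using (here; there)
open import Data.Nat using (ℕ; suc; _<_; _≤_; _≥_; z≤n; s≤s; z<s; s<s)
open import Data.Nat.Properties
  using (<-isStrictTotalOrder; ≤∧≢⇒<; <-trans; <-≤-trans; n<1+n; ≤-pred; suc-injective; <-pred; <-irrefl)
open import Data.Product using (∃-syntax; _×_; _,_; swap)
open import Data.Sum using (_⊎_; inj₁; inj₂)
open import Data.Vec.Functional using (Vector; updateAt)
open import Data.Vec.Functional.Properties using (updateAt-updates; updateAt-minimal)
open import Function using (id; const; _∘_; _on_)
open import Function.Definitions using (Injective)
open import Level using (Level)
open import Relation.Binary.Bundles using (TotalOrder)
import Relation.Binary.Construct.StrictToNonStrict as StrictToNonStrict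
open import Relation.Binary.Definitions using (DecidableEquality)
open import Relation.Binary.Morphism using (IsOrderMonomorphism)
import Relation.Binary.Morphism.OrderMonomorphism as OrderMonomorphism
open import Relation.Binary.PropositionalEquality
open import Relation.Binary.Structures using (IsStrictTotalOrder)
open import Relation.Nullary using (¬_; Dec; yes; no; contradiction)

private variable
  ℓ : Level
  A : Set ℓ
  m n : ℕ

HasThird : Set ℓ → Set ℓ
HasThird A = ∀ (x y : A) → ∃[ z ] z ≢ x × z ≢ y

_[_]≔_ : Vector A n → Fin n → A → Vector A n
a [ i ]≔ y = updateAt a i (const y)

[]≔-updates : ∀ (a : Vector A n) i {y} → (a [ i ]≔ y) i ≡ y
[]≔-updates a i = updateAt-updates i a

[]≔-minimal : ∀ (a : Vector A n) {i k y} → k ≢ i → (a [ i ]≔ y) k ≡ a k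
[]≔-minimal a {i} {k} = updateAt-minimal k i a

[]≔-id : ∀ (a : Vector A n) {i y} → a i ≡ y → a [ i ]≔ y ≗ a
[]≔-id a {i} ai≡y k with k ≟ᶠ i
... | yes refl = trans ([]≔-updates a k) (sym ai≡y)
... | no k≢i = []≔-minimal a k≢i

[]≔-towards : ∀ (a b : Vector A n) {k l} → a l ≡ b l → (a [ k ]≔ b k) l ≡ b l
[]≔-towards a b {k} {l} al≡bl with l ≟ᶠ k
... | yes refl = []≔-updates a l
... | no l≢k = trans ([]≔-minimal a l≢k) al≡bl

[]≔-pointwise : ∀ {p} (P : Fin n → A → Set p) {a : Vector A n} {i y} →
                (∀ k → k ≢ i → P k (a k)) → P i y → ∀ k → P k ((a [ i ]≔ y) k)
[]≔-pointwise P {a} {i} elsewhere at-i k with k ≟ᶠ i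
... | yes refl = subst (P k) (sym ([]≔-updates a k)) at-i
... | no k≢i   = subst (P k) (sym ([]≔-minimal a k≢i)) (elsewhere k k≢i)

Constant : Vector A n → Set _
Constant a = ∀ i j → a i ≡ a j

module _ {A : Set ℓ} (_≟_ : DecidableEquality A) where

  constant? : ∀ {n} (a : Vector A n) → Dec (Constant a)
  constant? a = all? λ i → all? λ j → a i ≟ a j

  ¬constant⇒∃≢ : ∀ {n} {a : Vector A n} → ¬ Constant a → ∀ v → ∃[ l ] a l ≢ v
  ¬constant⇒∃≢ {n} {a} nc v with all? (λ l → a l ≟ v)
  ... | yes all≡v = contradiction (λ i j → trans (all≡v i) (sym (all≡v j))) nc
  ... | no ¬all≡v = ¬∀⟶∃¬ n _ (λ l → a l ≟ v) ¬all≡v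

module OnNonConstant
  {A : Set} (_≟_ : DecidableEquality A) (third : HasThird A)
  {n} (thirdIndividual : HasThird (Fin n))
  {B : Set} (h : Vector A n → B) (h-cong : ∀ {a b} → a ≗ b → h a ≡ h b)
  (h-move : ∀ {a i j x y z} → a i ≡ x → a j ≡ z → j ≢ i → z ≢ x → z ≢ y → y ≢ x →
            h a ≡ h (a [ i ]≔ y))
  where

  -- Voter l shares i's top x and voter k already has y: l steps aside to a third
  -- alternative z while i moves, then returns.
  h-detour : ∀ {a i k l y} → a l ≡ a i → a k ≡ y → y ≢ a i → l ≢ i → h a ≡ h (a [ i ]≔ y)
  h-detour {a} {i} {k} {l} {y} al≡x ak≡y y≢x l≢i with third (a i) y
  ... | z , z≢x , z≢y = begin
    h a    ≡⟨ h-move al≡x ak≡y k≢l y≢x (z≢y ∘ sym) z≢x ⟩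
    h a₁   ≡⟨ h-move ([]≔-minimal a (l≢i ∘ sym)) ([]≔-updates a l) l≢i z≢x z≢y y≢x ⟩
    h a₂   ≡⟨ h-move a₂l≡z ([]≔-updates a₁ i) (l≢i ∘ sym) (z≢y ∘ sym) y≢x (z≢x ∘ sym) ⟩
    h a₃   ≡⟨ h-cong a₃≗b ⟩
    h (a [ i ]≔ y) ∎
    where
    open ≡-Reasoning
    k≢l : k ≢ l
    k≢l refl = y≢x (trans (sym ak≡y) al≡x)
    a₁ a₂ a₃ : Vector A n
    a₁ = a [ l ]≔ z
    a₂ = a₁ [ i ]≔ y
    a₃ = a₂ [ l ]≔ a i
    a₂l≡z : a₂ l ≡ z
    a₂l≡z = trans ([]≔-minimal a₁ l≢i) ([]≔-updates a l)
    a₃≗b : a₃ ≗ a [ i ]≔ y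
    a₃≗b p with p ≟ᶠ l | p ≟ᶠ i
    ... | yes refl | _ = trans ([]≔-updates a₂ p) (sym (trans ([]≔-minimal a l≢i) al≡x))
    ... | no p≢l | yes refl =
      trans ([]≔-minimal a₂ p≢l) (trans ([]≔-updates a₁ p) (sym ([]≔-updates a p)))
    ... | no p≢l | no p≢i = trans ([]≔-minimal a₂ p≢l) (trans ([]≔-minimal a₁ p≢i)
                              (trans ([]≔-minimal a p≢l) (sym ([]≔-minimal a p≢i))))

  h-update : ∀ {a} i y → ¬ Constant a → ¬ Constant (a [ i ]≔ y) → h a ≡ h (a [ i ]≔ y)
  h-update {a} i y nc nc′ with y ≟ a i
  ... | yes refl = h-cong (λ p → sym ([]≔-id a refl p))
  ... | no y≢x with ¬constant⇒∃≢ _≟_ nc (a i) | ¬constant⇒∃≢ _≟_ nc′ y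
  ... | k , ak≢x | l , bl≢y = by-cases (a k ≟ y) (a l ≟ a i)
    where
    l≢i : l ≢ i
    l≢i refl = bl≢y ([]≔-updates a l)
    al≢y : a l ≢ y
    al≢y = bl≢y ∘ trans ([]≔-minimal a l≢i)
    by-cases : Dec (a k ≡ y) → Dec (a l ≡ a i) → h a ≡ h (a [ i ]≔ y)
    by-cases (no ak≢y)  _          = h-move refl refl (ak≢x ∘ cong a) ak≢x ak≢y y≢x
    by-cases (yes _)    (no al≢x)  = h-move refl refl l≢i al≢x al≢y y≢x
    by-cases (yes ak≡y) (yes al≡x) = h-detour al≡x ak≡y y≢x l≢i

  h-step : ∀ {a b} → ¬ Constant a → ¬ Constant b → ∀ k →
           ∃[ a′ ] ¬ Constant a′ × h a ≡ h a′ × a′ k ≡ b k × (∀ l → a l ≡ b l → a′ l ≡ b l)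
  h-step {a} {b} nca ncb k with constant? _≟_ (a [ k ]≔ b k)
  ... | no nc′ =
    a [ k ]≔ b k , nc′ , h-update k (b k) nca nc′ , []≔-updates a k , λ l → []≔-towards a b
  ... | yes c′ with ¬constant⇒∃≢ _≟_ ncb (b k)
  ...   | j , bj≢bk with thirdIndividual j k
  ...     | t , t≢j , t≢k =
    a₂ , nc₂ , trans (h-update j (b j) nca nc₁) (h-update k (b k) nc₁ nc₂) ,
    []≔-updates a₁ k , λ l → []≔-towards a₁ b ∘ []≔-towards a b
    where
    a₁ a₂ : Vector A n
    a₁ = a [ j ]≔ b j
    a₂ = a₁ [ k ]≔ b k
    j≢k : j ≢ k
    j≢k refl = bj≢bk refl
    ak≢bk : a k ≢ b k
    ak≢bk ak≡bk = nca λ p q → trans (sym ([]≔-id a ak≡bk p)) (trans (c′ p q) ([]≔-id a ak≡bk q))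
    nc₁ : ¬ Constant a₁
    nc₁ c₁ = ak≢bk (begin
      a k   ≡⟨ sym ([]≔-minimal a (j≢k ∘ sym)) ⟩
      a₁ k  ≡⟨ c₁ k t ⟩
      a₁ t  ≡⟨ []≔-minimal a t≢j ⟩
      a t   ≡⟨ sym ([]≔-minimal a t≢k) ⟩
      (a [ k ]≔ b k) t ≡⟨ c′ t k ⟩
      (a [ k ]≔ b k) k ≡⟨ []≔-updates a k ⟩
      b k   ∎)
      where open ≡-Reasoning
    nc₂ : ¬ Constant a₂
    nc₂ c₂ = bj≢bk (trans (sym (trans ([]≔-minimal a₁ j≢k) ([]≔-updates a j)))
                          (trans (c₂ j k) ([]≔-updates a₁ k)))

  h-path : ∀ {a b} ks → ¬ Constant a → ¬ Constant b → (∀ l → l ∉ ks → a l ≡ b l) →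
           h a ≡ h b
  h-path []       nca ncb agree = h-cong λ l → agree l λ ()
  h-path {b = b} (k ∷ ks) nca ncb agree with h-step nca ncb k
  ... | a′ , nc′ , ha≡ha′ , a′k≡bk , keeps = trans ha≡ha′ (h-path ks nc′ ncb agree′)
    where
    agree′ : ∀ l → l ∉ ks → a′ l ≡ b l
    agree′ l l∉ks with l ≟ᶠ k
    ... | yes refl = a′k≡bk
    ... | no l≢k = keeps l (agree l λ { (here l≡k) → l≢k l≡k ; (there l∈ks) → l∉ks l∈ks })

  h-constant : ∀ {a b} → ¬ Constant a → ¬ Constant b → h a ≡ h b
  h-constant nca ncb = h-path (allFin n) nca ncb λ l l∉ → contradiction (∈-allFin l) l∉

byRank : (r : Fin m → ℕ) → Injective _≡_ _≡_ r → Ordering m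
byRank r r-inj = record
  { _≻_   = _<_ on r
  ; isSTO = OrderMonomorphism.isStrictTotalOrder r-mono <-isStrictTotalOrder
  }
  where
  r-mono : IsOrderMonomorphism _≡_ _≡_ (_<_ on r) _<_ r
  r-mono = record
    { isOrderHomomorphism = record { cong = cong r ; mono = id }
    ; injective           = r-inj
    ; cancel              = id
    }

module _ {r : Fin m → ℕ} (r-inj : Injective _≡_ _≡_ r) where

  byRank-IsTop : ∀ {x} → r x ≡ 0 → IsTop (byRank r r-inj) x
  byRank-IsTop rx≡0 y y≢x rewrite rx≡0 =
    ≤∧≢⇒< z≤n λ 0≡ry → y≢x (r-inj (trans (sym 0≡ry) (sym rx≡0)))

  byRank-ImmAbove : ∀ {x y} → r y ≡ suc (r x) → ImmAbove (byRank r r-inj) x y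
  byRank-ImmAbove {x} {y} ry≡1+rx =
    subst (r x <_) (sym ry≡1+rx) (n<1+n (r x)) ,
    λ z (rx<rz , rz<ry) → <-irrefl refl (<-≤-trans rx<rz (≤-pred (subst (r z <_) ry≡1+rx rz<ry)))

  byRank-Swapped : ∀ {s : Fin m → ℕ} (s-inj : Injective _≡_ _≡_ s) {x y} →
                   r y ≡ suc (r x) → s x ≡ r y → s y ≡ r x → (∀ e → e ≢ x → e ≢ y → s e ≡ r e) →
                   Swapped (byRank r r-inj) x y (byRank s s-inj)
  byRank-Swapped {s} s-inj {x} {y} ry≡1+rx sx≡ry sy≡rx s≡r =
    preserved , subst₂ _<_ (sym sy≡rx) (sym sx≡ry) rx<ry
    where
    rx<ry : r x < r y
    rx<ry = subst (r x <_) (sym ry≡1+rx) (n<1+n (r x))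
    below : ∀ e → e ≢ x → (r e < r x → r e < r y) × (r e < r y → r e < r x)
    below e e≢x = (λ lt → <-trans lt rx<ry) ,
                  (λ lt → ≤∧≢⇒< (≤-pred (subst (r e <_) ry≡1+rx lt)) (e≢x ∘ r-inj))
    above : ∀ e → e ≢ y → (r x < r e → r y < r e) × (r y < r e → r x < r e)
    above e e≢y = (λ lt → ≤∧≢⇒< (subst (_≤ r e) (sym ry≡1+rx) lt) (e≢y ∘ sym ∘ r-inj)) ,
                  <-trans rx<ry
    irreflexive : ∀ {e} → (r e < r e → s e < s e) × (s e < s e → r e < r e)
    irreflexive = (λ lt → contradiction lt (<-irrefl refl)) ,
                  (λ lt → contradiction lt (<-irrefl refl))
    preserved : ∀ a b → ¬ ((a ≡ x × b ≡ y) ⊎ (a ≡ y × b ≡ x)) →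
                (r a < r b → s a < s b) × (s a < s b → r a < r b)
    preserved a b not-xy with a ≟ᶠ x | a ≟ᶠ y | b ≟ᶠ x | b ≟ᶠ y
    ... | yes refl | _        | yes refl | _        = irreflexive
    ... | yes refl | _        | no _     | yes refl = contradiction (inj₁ (refl , refl)) not-xy
    ... | yes refl | _        | no b≢x   | no b≢y   rewrite sx≡ry | s≡r b b≢x b≢y = above b b≢y
    ... | no _     | yes refl | yes refl | _        = contradiction (inj₂ (refl , refl)) not-xy
    ... | no _     | yes refl | no _     | yes refl = irreflexive
    ... | no _     | yes refl | no b≢x   | no b≢y   rewrite sy≡rx | s≡r b b≢x b≢y = swap (above b b≢y)
    ... | no a≢x   | no a≢y   | yes refl | _        rewrite s≡r a a≢x a≢y | sx≡ry = below a a≢x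
    ... | no a≢x   | no a≢y   | no _     | yes refl rewrite s≡r a a≢x a≢y | sy≡rx = swap (below a a≢x)
    ... | no a≢x   | no a≢y   | no b≢x   | no b≢y
      rewrite s≡r a a≢x a≢y | s≡r b b≢x b≢y = id , id

raise : Fin m → (Fin m → ℕ) → Fin m → ℕ
raise x r e with e ≟ᶠ x
... | yes _ = 0
... | no _  = suc (r e)

module _ {x : Fin m} {r : Fin m → ℕ} where

  raise-self : raise x r x ≡ 0
  raise-self with x ≟ᶠ x
  ... | yes _   = refl
  ... | no x≢x = contradiction refl x≢x

  raise-other : ∀ {e} → e ≢ x → raise x r e ≡ suc (r e)
  raise-other {e} e≢x with e ≟ᶠ x
  ... | yes e≡x = contradiction e≡x e≢x
  ... | no _    = refl

  raise-injective : Injective _≡_ _≡_ r → Injective _≡_ _≡_ (raise x r)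
  raise-injective r-inj {a} {b} eq with a ≟ᶠ x | b ≟ᶠ x
  ... | yes refl | yes refl = refl
  ... | no _     | no _     = r-inj (suc-injective eq)

rankListedFirst : List (Fin m) → Fin m → ℕ
rankListedFirst []       = toℕ
rankListedFirst (x ∷ xs) = raise x (rankListedFirst xs)

rankListedFirst-injective : ∀ (xs : List (Fin m)) → Injective _≡_ _≡_ (rankListedFirst xs)
rankListedFirst-injective []       = toℕ-injective
rankListedFirst-injective (x ∷ xs) = raise-injective (rankListedFirst-injective xs)

listedFirst : List (Fin m) → Ordering m
listedFirst xs = byRank (rankListedFirst xs) (rankListedFirst-injective xs)

listedFirst-IsTop : ∀ x (xs : List (Fin m)) → IsTop (listedFirst (x ∷ xs)) x
listedFirst-IsTop x xs = byRank-IsTop (rankListedFirst-injective (x ∷ xs)) raise-self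

raise-adjacent : ∀ {x y z : Fin m} {r} → x ≢ z → y ≢ z → r y ≡ suc (r x) →
                 raise z r y ≡ suc (raise z r x)
raise-adjacent x≢z y≢z ry≡1+rx =
  trans (raise-other y≢z) (cong suc (trans ry≡1+rx (sym (raise-other x≢z))))

rankListedFirst-second : ∀ {x y : Fin m} xs → x ≢ y → rankListedFirst (x ∷ y ∷ xs) y ≡ 1
rankListedFirst-second xs x≢y = trans (raise-other (x≢y ∘ sym)) (cong suc raise-self)

rankListedFirst-adjacent : ∀ {x y : Fin m} xs → x ≢ y →
                           rankListedFirst (x ∷ y ∷ xs) y ≡ suc (rankListedFirst (x ∷ y ∷ xs) x)
rankListedFirst-adjacent xs x≢y = trans (rankListedFirst-second xs x≢y) (cong suc (sym raise-self))

listedFirst-ImmAbove : ∀ (xs : List (Fin m)) {x y} → rankListedFirst xs y ≡ suc (rankListedFirst xs x) →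
                       ImmAbove (listedFirst xs) x y
listedFirst-ImmAbove xs = byRank-ImmAbove (rankListedFirst-injective xs)

listedFirst-Swapped : ∀ {x y : Fin m} xs → x ≢ y →
                      Swapped (listedFirst (x ∷ y ∷ xs)) x y (listedFirst (y ∷ x ∷ xs))
listedFirst-Swapped {x = x} {y} xs x≢y =
  byRank-Swapped (rankListedFirst-injective (x ∷ y ∷ xs)) (rankListedFirst-injective (y ∷ x ∷ xs))
    (rankListedFirst-adjacent xs x≢y)
    (trans (rankListedFirst-second xs (x≢y ∘ sym)) (sym (rankListedFirst-second xs x≢y)))
    (trans raise-self (sym raise-self))
    λ e e≢x e≢y → trans (raise-other e≢y) (trans (cong suc (raise-other e≢x))
                    (sym (trans (raise-other e≢x) (cong suc (raise-other e≢y)))))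

listedFirst-cons-Swapped : ∀ {x y : Fin m} z xs ys → x ≢ z → y ≢ z →
                           Swapped (listedFirst xs) x y (listedFirst ys) →
                           Swapped (listedFirst (z ∷ xs)) x y (listedFirst (z ∷ ys))
listedFirst-cons-Swapped {x = x} {y} z xs ys x≢z y≢z (preserved , y≻x) =
  preserved′ , subst₂ _<_ (sym (raise-other y≢z)) (sym (raise-other x≢z)) (s<s y≻x)
  where
  r s : Fin _ → ℕ
  r = rankListedFirst xs
  s = rankListedFirst ys
  preserved′ : ∀ a b → ¬ ((a ≡ x × b ≡ y) ⊎ (a ≡ y × b ≡ x)) →
               (raise z r a < raise z r b → raise z s a < raise z s b) ×
               (raise z s a < raise z s b → raise z r a < raise z r b)
  preserved′ a b not-xy with a ≟ᶠ z | b ≟ᶠ z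
  ... | yes _ | yes _ = id , id
  ... | yes _ | no _  = (λ _ → z<s) , (λ _ → z<s)
  ... | no _  | yes _ = (λ ()) , (λ ())
  ... | no _  | no _  = let (to , from) = preserved a b not-xy in s<s ∘ to ∘ <-pred , s<s ∘ from ∘ <-pred

≽-totalOrder : Ordering m → TotalOrder _ _ _
≽-totalOrder r = record { isTotalOrder = StrictToNonStrict.isTotalOrder _≡_ (_≻_ r) (isSTO r) }

module _ (r : Ordering (suc m)) where
  open Data.List.Extrema (≽-totalOrder r) using (min; min≤xs)

  top : Fin (suc m)
  top = min zero (allFin _)

  top-IsTop : IsTop r top
  top-IsTop y y≢top with lookup (min≤xs zero (allFin _)) (∈-allFin y)
  ... | inj₁ top≻y = top≻y
  ... | inj₂ top≡y = contradiction (sym top≡y) y≢top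

IsTop-unique : ∀ (r : Ordering m) {x y} → IsTop r x → IsTop r y → x ≡ y
IsTop-unique r {x} {y} x-top y-top with x ≟ᶠ y
... | yes x≡y = x≡y
... | no x≢y  = contradiction (y-top x x≢y) (IsStrictTotalOrder.asym (isSTO r) (x-top y (x≢y ∘ sym)))

module _ {w : Profile m n} {i j : Fin n} {x y : Fin m} {pᵢ qᵢ pⱼ qⱼ : Ordering m} where

  transpositionPair-[]≔ : i ≢ j → ImmAbove pᵢ x y → ImmAbove pⱼ y x →
                          Swapped pᵢ x y qᵢ → Swapped pⱼ y x qⱼ →
                          TranspositionPair ((w [ i ]≔ pᵢ) [ j ]≔ pⱼ) ((w [ i ]≔ qᵢ) [ j ]≔ qⱼ) x y i j
  transpositionPair-[]≔ i≢j imm-i imm-j swap-i swap-j =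
    subst (λ o → ImmAbove o x y) (sym (at-i pᵢ pⱼ)) imm-i ,
    subst (λ o → ImmAbove o y x) (sym (at-j pᵢ pⱼ)) imm-j ,
    subst₂ (λ o o′ → Swapped o x y o′) (sym (at-i pᵢ pⱼ)) (sym (at-i qᵢ qⱼ)) swap-i ,
    subst₂ (λ o o′ → Swapped o y x o′) (sym (at-j pᵢ pⱼ)) (sym (at-j qᵢ qⱼ)) swap-j ,
    λ k k≢i k≢j → subst₂ SameOrder (sym (elsewhere pᵢ pⱼ k≢i k≢j)) (sym (elsewhere qᵢ qⱼ k≢i k≢j))
                    λ _ _ → id , id
    where
    at-i : ∀ p q → ((w [ i ]≔ p) [ j ]≔ q) i ≡ p
    at-i p q = trans ([]≔-minimal (w [ i ]≔ p) i≢j) ([]≔-updates w i)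
    at-j : ∀ p q → ((w [ i ]≔ p) [ j ]≔ q) j ≡ q
    at-j p q = []≔-updates (w [ i ]≔ p) j
    elsewhere : ∀ p q {k} → k ≢ i → k ≢ j → ((w [ i ]≔ p) [ j ]≔ q) k ≡ w k
    elsewhere p q k≢i k≢j = trans ([]≔-minimal (w [ i ]≔ p) k≢j) ([]≔-minimal w k≢i)

module TopsOnlyReduction {m n} (G : SCC m n) (tops-only : TopsOnly G) where

  canonical : Vector (Fin m) n → Profile m n
  canonical a k = listedFirst (a k ∷ [])

  g : Vector (Fin m) n → Subset m
  g a = G (canonical a)

  canonical-IsTop : ∀ a k → IsTop (canonical a k) (a k)
  canonical-IsTop a k = listedFirst-IsTop (a k) []

  G≡g : ∀ {u a} → (∀ k → IsTop (u k) (a k)) → G u ≡ g a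
  G≡g {u} {a} u-tops = tops-only u (canonical a) λ k x →
    (λ x-top → subst (IsTop (canonical a k)) (IsTop-unique (u k) (u-tops k) x-top)
                 (canonical-IsTop a k)) ,
    (λ x-top → subst (IsTop (u k)) (IsTop-unique (canonical a k) (canonical-IsTop a k) x-top)
                 (u-tops k))

  g-cong : ∀ {a b} → a ≗ b → g a ≡ g b
  g-cong {a} a≗b = G≡g λ k → subst (IsTop (canonical a k)) (a≗b k) (canonical-IsTop a k)

  g-move : Balanced G → ∀ {a i j x y z} → a i ≡ x → a j ≡ z → j ≢ i → z ≢ x → z ≢ y → y ≢ x →
           g a ≡ g (a [ i ]≔ y)
  g-move balanced {a} {i} {j} {x} {y} {z} ai≡x aj≡z j≢i z≢x z≢y y≢x = begin
    g a             ≡⟨ sym (G≡g u-tops) ⟩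
    G u             ≡⟨ sym (balanced u v x y i j transposition) ⟩
    G v             ≡⟨ G≡g v-tops ⟩
    g (a [ i ]≔ y)  ∎
    where
    open ≡-Reasoning
    u v : Profile m n
    u = (canonical a [ i ]≔ listedFirst (x ∷ y ∷ [])) [ j ]≔ listedFirst (z ∷ y ∷ x ∷ [])
    v = (canonical a [ i ]≔ listedFirst (y ∷ x ∷ [])) [ j ]≔ listedFirst (z ∷ x ∷ y ∷ [])
    transposition : TranspositionPair u v x y i j
    transposition = transpositionPair-[]≔ (j≢i ∘ sym)
      (listedFirst-ImmAbove (x ∷ y ∷ []) (rankListedFirst-adjacent [] (y≢x ∘ sym)))
      (listedFirst-ImmAbove (z ∷ y ∷ x ∷ [])
        (raise-adjacent (z≢y ∘ sym) (z≢x ∘ sym) (rankListedFirst-adjacent [] y≢x)))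
      (listedFirst-Swapped [] (y≢x ∘ sym))
      (listedFirst-cons-Swapped z (y ∷ x ∷ []) (x ∷ y ∷ []) (z≢y ∘ sym) (z≢x ∘ sym)
        (listedFirst-Swapped [] y≢x))
    top-of : ∀ {t} x xs → x ≡ t → IsTop (listedFirst (x ∷ xs)) t
    top-of x xs refl = listedFirst-IsTop x xs
    tops-of : Vector (Fin m) n → Fin n → Ordering m → Set
    tops-of c k o = IsTop o (c k)
    u-tops : ∀ k → IsTop (u k) (a k)
    u-tops = []≔-pointwise (tops-of a)
      (λ k _ → []≔-pointwise (tops-of a) (λ k _ → canonical-IsTop a k) (top-of x (y ∷ []) (sym ai≡x)) k)
      (top-of z (y ∷ x ∷ []) (sym aj≡z))
    v-tops : ∀ k → IsTop (v k) ((a [ i ]≔ y) k)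
    v-tops = []≔-pointwise (tops-of (a [ i ]≔ y))
      (λ k _ → []≔-pointwise (tops-of (a [ i ]≔ y))
                 (λ k k≢i → subst (IsTop (canonical a k)) (sym ([]≔-minimal a k≢i)) (canonical-IsTop a k))
                 (top-of y (x ∷ []) (sym ([]≔-updates a i))) k)
      (top-of z (x ∷ y ∷ []) (sym (trans ([]≔-minimal a j≢i) aj≡z)))

¬Unanimous⇒¬Constant : ∀ (u : Profile m n) {a} → Fin n → (∀ k → IsTop (u k) (a k)) →
                       ¬ Unanimous u → ¬ Constant a
¬Unanimous⇒¬Constant u {a} i₀ u-tops ¬unanimous c =
  ¬unanimous (a i₀ , λ k → subst (IsTop (u k)) (c k i₀) (u-tops k))

third : ∀ {k} → HasThird (Fin (suc (suc (suc k))))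
third (suc _)       (suc _)       = zero , (λ ()) , (λ ())
third zero          zero          = suc zero , (λ ()) , (λ ())
third zero          (suc zero)    = suc (suc zero) , (λ ()) , (λ ())
third zero          (suc (suc _)) = suc zero , (λ ()) , (λ ())
third (suc zero)    zero          = suc (suc zero) , (λ ()) , (λ ())
third (suc (suc _)) zero          = suc zero , (λ ()) , (λ ())

theorem2 : (m n : ℕ) → m ≥ 3 → n ≥ 3 → (G : SCC m n) → IsSCC G →
           TopsOnly G → Balanced G →
           ∀ (u v : Profile m n) → ¬ Unanimous u → ¬ Unanimous v → G u ≡ G v
theorem2 _ _ (s≤s (s≤s (s≤s _))) (s≤s (s≤s (s≤s _))) G _ tops-only balanced
         u v ¬unanimous-u ¬unanimous-v =
  begin
    G u          ≡⟨ G≡g (top-IsTop ∘ u) ⟩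
    g (top ∘ u)  ≡⟨ h-constant (¬Unanimous⇒¬Constant u zero (top-IsTop ∘ u) ¬unanimous-u)
                               (¬Unanimous⇒¬Constant v zero (top-IsTop ∘ v) ¬unanimous-v) ⟩
    g (top ∘ v)  ≡⟨ G≡g (top-IsTop ∘ v) ⟨
    G v          ∎
  where
  open ≡-Reasoning
  open TopsOnlyReduction G tops-only
  open OnNonConstant _≟ᶠ_ third third g g-cong (g-move balanced)
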